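{- Let $n$ be a non-zero integer. If $\{a,b,c\}$ is an irregular $D(n)$-triple with $a<b<c$ and $c>n^2$, then \[ c>\frac{3ab}{n^2}. \]
   Context: For a non-zero integer $n$, a $D(n)$-triple is a set of three distinct positive integers such that the product of any two of them plus $n$ is a perfect square. A $D(n)$-triple $\{a,b,c\}$ with $a<b<c$ is regular if $c=a+b+2r$, where $r\ge0$ and $r^2=ab+n$; it is irregular if it is not regular. -}

module Defs where

open import Data.Integer using (ℤ; _+_; _*_; _<_; _≤_; +_)
open import Data.Product using (Σ; ∃; _×_)
open import Relation.Nullary using (¬_)
open import Relation.Binary.PropositionalEquality using (_≡_)

IsSquare : ℤ → Set
IsSquare m = ∃ λ k → k * k ≡ m

DTriple : ℤ → ℤ → ℤ → ℤ → Set
DTriple n a b c =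
  (+ 0 < a) × (a < b) × (b < c) ×
  IsSquare (a * b + n) × IsSquare (a * c + n) × IsSquare (b * c + n)

Regular : ℤ → ℤ → ℤ → ℤ → Set
Regular n a b c = ∃ λ r → (+ 0 ≤ r) × (r * r ≡ a * b + n) × (c ≡ a + b + + 2 * r)

Irregular : ℤ → ℤ → ℤ → ℤ → Set
Irregular n a b c = ¬ Regular n a b c

-- Let r, s, t ≥ 0 be the square roots of ab + n, ac + n, bc + n, and e = n(a+b+c) + 2abc − 2rst.
-- From (cr − st)² = ce + n² and c > n² we get e ≥ 0, and e(e + 4rst) = n²(c − a − b − 2r)(c − a − b + 2r).
-- If e = 0 then c = a + b ± 2r: the plus sign makes the triple regular, the minus sign gives
-- c ≤ ab − r² = −n ≤ n². If e ≥ 1 then n²c² − 3abc = (e − 1)(e − 1 + 4rst) + R with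
-- R = n²(a+b)(2c−a−b) + 4n²r² + 2n(a+b+c) + abc − 1, which is positive once r ≥ 1.
-- The remaining case r = 0 means n = −ab, and then n²c = (ab)²c > 3ab.
module Submission where

open import Defs
open import Data.Integer using (ℤ; _*_; _<_; +_)
open import Relation.Binary.PropositionalEquality using (_≢_)

open import Algebra.Bundles using (AbelianGroup)
open import Data.Empty using (⊥-elim)
open import Data.Integer using (-[1+_]; 0ℤ; -1ℤ; _+_; _-_; -_; _≤_; +≤+; -≤+; -≤-; +<+; ∣_∣; nonNegative)
open import Data.Integer.Properties
  using ( +-0-abelianGroup; pos-*; +-inverseʳ; *-zeroˡ; _≟_
        ; ≤-trans; <-trans; <⇒≤; <⇒≱; ≤∧≢⇒<; <-irrefl; i≤j⇒0≤j-i; i<j⇒suc[i]≤j; suc[i]≤j⇒i<j; i≤i+j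
        ; +-monoˡ-≤; +-monoˡ-<; *-monoˡ-≤-nonNeg; *-cancelˡ-<-nonNeg; i*j≡0⇒i≡0∨j≡0; i-j≡0⇒i≡j
        ; module ≤-Reasoning )
open import Data.Integer.Tactic.RingSolver using (solve-∀; solve)
open import Data.List using ([]; _∷_)
open import Data.Nat as ℕ using (ℕ; zero; suc; z≤n; s≤s)
import Data.Nat.Properties as ℕ
open import Data.Product using (∃; _,_)
open import Data.Sum using (_⊎_; [_,_]′)
import Data.Sum as Sum
open import Function using (_∘_; case_of_)
open import Relation.Binary.PropositionalEquality
  using (_≡_; refl; sym; trans; cong; cong₂; subst; module ≡-Reasoning)
open import Relation.Nullary using (yes; no)
open import Algebra.Properties.Group (AbelianGroup.group +-0-abelianGroup)
  using (inverseʳ-unique) renaming (∙-cancelʳ to +-cancelʳ)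

infixl 6 _⊕_
infixl 7 _⊗_

0≤+ : ∀ m → 0ℤ ≤ + m
0≤+ _ = +≤+ z≤n

_⊕_ : ∀ {i j} → 0ℤ ≤ i → 0ℤ ≤ j → 0ℤ ≤ i + j
+≤+ _ ⊕ +≤+ _ = +≤+ z≤n

_⊗_ : ∀ {i j} → 0ℤ ≤ i → 0ℤ ≤ j → 0ℤ ≤ i * j
_⊗_ {+ m} {+ n} _ _ = subst (0ℤ ≤_) (pos-* m n) (0≤+ (m ℕ.* n))

0≤i*i : ∀ i → 0ℤ ≤ i * i
0≤i*i (+ m)    = 0≤+ m ⊗ 0≤+ m
0≤i*i -[1+ m ] = +≤+ z≤n

0≤i*[i+1] : ∀ i → 0ℤ ≤ i * (i + + 1)
0≤i*[i+1] (+ m)        = 0≤+ m ⊗ 0≤+ (m ℕ.+ 1)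
0≤i*[i+1] -[1+ zero ]  = +≤+ z≤n
0≤i*[i+1] -[1+ suc m ] = +≤+ z≤n

i≤i*i : ∀ i → i ≤ i * i
i≤i*i (+ zero)  = +≤+ z≤n
i≤i*i (+ suc m) = +≤+ (ℕ.m≤m*n (suc m) (suc m))
i≤i*i -[1+ m ]  = -≤+

i<j⇒0≤j-[1+i] : ∀ {i j} → i < j → 0ℤ ≤ j - (+ 1 + i)
i<j⇒0≤j-[1+i] = i≤j⇒0≤j-i ∘ i<j⇒suc[i]≤j

≤-by-gap : ∀ {i j δ} → 0ℤ ≤ δ → i + δ ≡ j → i ≤ j
≤-by-gap {i} {δ = δ} 0≤δ refl = i≤i+j i δ {{nonNegative 0≤δ}}

<-by-gap : ∀ {i j δ} → 0ℤ ≤ δ → + 1 + i + δ ≡ j → i < j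
<-by-gap 0≤δ eq = suc[i]≤j⇒i<j (≤-by-gap 0≤δ eq)

0≤i*j+k⇒0≤j : ∀ {i j k} → 0ℤ ≤ i → k < i → 0ℤ ≤ i * j + k → 0ℤ ≤ j
0≤i*j+k⇒0≤j {j = + m} _ _ _ = 0≤+ m
0≤i*j+k⇒0≤j {i} { -[1+ m ]} {k} 0≤i k<i 0≤ij+k = ⊥-elim (<-irrefl refl (begin-strict
  0ℤ                ≤⟨ 0≤ij+k ⟩
  i * -[1+ m ] + k  ≤⟨ +-monoˡ-≤ k (*-monoˡ-≤-nonNeg i {{nonNegative 0≤i}} (-≤- z≤n)) ⟩
  i * -1ℤ + k       ≡⟨ solve (i ∷ k ∷ []) ⟩
  k - i             <⟨ +-monoˡ-< (- i) k<i ⟩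
  i - i             ≡⟨ +-inverseʳ i ⟩
  0ℤ                ∎))
  where open ≤-Reasoning

i+j≡0⇒j≡-i : ∀ {i j} → i + j ≡ 0ℤ → j ≡ - i
i+j≡0⇒j≡-i = inverseʳ-unique _ _

natural-root : ∀ {m} → IsSquare m → ∃ λ (k : ℕ) → + k * + k ≡ m
natural-root (i , i*i≡m) = ∣ i ∣ , trans (∣i∣*∣i∣≡i*i i) i*i≡m
  where
  ∣i∣*∣i∣≡i*i : ∀ i → + ∣ i ∣ * + ∣ i ∣ ≡ i * i
  ∣i∣*∣i∣≡i*i (+ _)    = refl
  ∣i∣*∣i∣≡i*i -[1+ _ ] = refl

-- Dujella's e for the triple, with w standing for rst.
dujella-e : ℤ → ℤ → ℤ → ℤ → ℤ → ℤ
dujella-e n a b c w = n * (a + b + c) + + 2 * a * b * c - + 2 * w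

module Roots (n a b c r s t : ℤ)
             (r² : r * r ≡ a * b + n) (s² : s * s ≡ a * c + n) (t² : t * t ≡ b * c + n) where

  [cr-st]²≡c*e+n² : (c * r - s * t) * (c * r - s * t) ≡ c * dujella-e n a b c (r * s * t) + n * n
  [cr-st]²≡c*e+n² = begin
    (c * r - s * t) * (c * r - s * t)
      ≡⟨ solve (c ∷ r ∷ s ∷ t ∷ []) ⟩
    c * c * (r * r) - + 2 * c * (r * s * t) + s * s * (t * t)
      ≡⟨ cong₂ (λ R ST → c * c * R - + 2 * c * (r * s * t) + ST) r² (cong₂ _*_ s² t²) ⟩
    c * c * (a * b + n) - + 2 * c * (r * s * t) + (a * c + n) * (b * c + n)
      ≡⟨ solve (n ∷ a ∷ b ∷ c ∷ r ∷ s ∷ t ∷ []) ⟩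
    c * (n * (a + b + c) + + 2 * a * b * c - + 2 * (r * s * t)) + n * n ∎
    where open ≡-Reasoning

  dujella-e-nonNeg : n * n < c → 0ℤ ≤ dujella-e n a b c (r * s * t)
  dujella-e-nonNeg n²<c =
    0≤i*j+k⇒0≤j {c} {dujella-e n a b c (r * s * t)} {n * n} 0≤c n²<c
      (subst (0ℤ ≤_) [cr-st]²≡c*e+n² (0≤i*i (c * r - s * t)))
    where
    0≤c : 0ℤ ≤ c
    0≤c = ≤-trans (0≤i*i n) (<⇒≤ n²<c)

  e*[e+4rst]≡n²[c-c₊][c-c₋] : let e = dujella-e n a b c (r * s * t) in
    e * (e + + 4 * (r * s * t)) ≡ n * n * ((c - (a + b + + 2 * r)) * (c - (a + b - + 2 * r)))
  e*[e+4rst]≡n²[c-c₊][c-c₋] = begin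
    (n * (a + b + c) + + 2 * a * b * c - + 2 * (r * s * t)) *
      (n * (a + b + c) + + 2 * a * b * c - + 2 * (r * s * t) + + 4 * (r * s * t))
      ≡⟨ solve (n ∷ a ∷ b ∷ c ∷ r ∷ s ∷ t ∷ []) ⟩
    (n * (a + b + c) + + 2 * a * b * c) * (n * (a + b + c) + + 2 * a * b * c)
      - + 4 * (r * r * (s * s) * (t * t))
      ≡⟨ cong (λ RST → (n * (a + b + c) + + 2 * a * b * c) * (n * (a + b + c) + + 2 * a * b * c) - + 4 * RST)
              (cong₂ _*_ (cong₂ _*_ r² s²) t²) ⟩
    (n * (a + b + c) + + 2 * a * b * c) * (n * (a + b + c) + + 2 * a * b * c)
      - + 4 * ((a * b + n) * (a * c + n) * (b * c + n))
      ≡⟨ solve (n ∷ a ∷ b ∷ c ∷ []) ⟩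
    n * n * ((c - a - b) * (c - a - b) - + 4 * (a * b + n))
      ≡⟨ cong (λ R → n * n * ((c - a - b) * (c - a - b) - + 4 * R)) r² ⟨
    n * n * ((c - a - b) * (c - a - b) - + 4 * (r * r))
      ≡⟨ solve (n ∷ a ∷ b ∷ c ∷ r ∷ []) ⟩
    n * n * ((c - (a + b + + 2 * r)) * (c - (a + b - + 2 * r))) ∎
    where open ≡-Reasoning

  e≡0⇒c≡a+b±2r : n ≢ 0ℤ → dujella-e n a b c (r * s * t) ≡ 0ℤ → c ≡ a + b + + 2 * r ⊎ c ≡ a + b - + 2 * r
  e≡0⇒c≡a+b±2r n≢0 e≡0 =
    [ (λ n²≡0 → ⊥-elim ([ n≢0 , n≢0 ]′ (i*j≡0⇒i≡0∨j≡0 n n²≡0)))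
    , (λ [c-c₊][c-c₋]≡0 → Sum.map (i-j≡0⇒i≡j c c₊) (i-j≡0⇒i≡j c c₋) (i*j≡0⇒i≡0∨j≡0 (c - c₊) [c-c₊][c-c₋]≡0))
    ]′ (i*j≡0⇒i≡0∨j≡0 (n * n) {(c - c₊) * (c - c₋)} n²[c-c₊][c-c₋]≡0)
    where
    c₊ c₋ e : ℤ
    c₊ = a + b + + 2 * r
    c₋ = a + b - + 2 * r
    e  = dujella-e n a b c (r * s * t)
    n²[c-c₊][c-c₋]≡0 : n * n * ((c - c₊) * (c - c₋)) ≡ 0ℤ
    n²[c-c₊][c-c₋]≡0 = begin
      n * n * ((c - c₊) * (c - c₋))           ≡⟨ e*[e+4rst]≡n²[c-c₊][c-c₋] ⟨
      e * (e + + 4 * (r * s * t))             ≡⟨ cong (λ x → x * (x + + 4 * (r * s * t))) e≡0 ⟩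
      0ℤ * (0ℤ + + 4 * (r * s * t))           ≡⟨ *-zeroˡ (0ℤ + + 4 * (r * s * t)) ⟩
      0ℤ                                      ∎
      where open ≡-Reasoning

ab+n≡0⇒3ab<n²c : ∀ n {a b c} → 0ℤ < a → a < b → b < c → a * b + n ≡ 0ℤ → + 3 * a * b < n * n * c
ab+n≡0⇒3ab<n²c n {a} {b} {c} 0<a a<b b<c ab+n≡0 =
  <-by-gap 0≤excess (trans (identity a b c) (cong (λ m → m * m * c) (sym n≡-ab)))
  where
  identity : ∀ a b c → let α = a - + 1; β = b - (+ 1 + a); γ = c - (+ 1 + b); u = α + β + α * b in
    + 1 + + 3 * a * b + (a * b * (a * b) * (α + β + γ) + + 3 * (u * u) + + 9 * u + + 5) ≡ - (a * b) * - (a * b) * c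
  identity = solve-∀
  α β γ u : ℤ
  α = a - + 1
  β = b - (+ 1 + a)
  γ = c - (+ 1 + b)
  u = α + β + α * b
  0≤α : 0ℤ ≤ α
  0≤α = i<j⇒0≤j-[1+i] 0<a
  0≤β : 0ℤ ≤ β
  0≤β = i<j⇒0≤j-[1+i] a<b
  0≤γ : 0ℤ ≤ γ
  0≤γ = i<j⇒0≤j-[1+i] b<c
  0≤u : 0ℤ ≤ u
  0≤u = 0≤α ⊕ 0≤β ⊕ 0≤α ⊗ <⇒≤ (<-trans 0<a a<b)
  0≤excess : 0ℤ ≤ a * b * (a * b) * (α + β + γ) + + 3 * (u * u) + + 9 * u + + 5
  0≤excess = 0≤i*i (a * b) ⊗ (0≤α ⊕ 0≤β ⊕ 0≤γ) ⊕ 0≤+ 3 ⊗ (0≤u ⊗ 0≤u) ⊕ 0≤+ 9 ⊗ 0≤u ⊕ 0≤+ 5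
  n≡-ab : n ≡ - (a * b)
  n≡-ab = i+j≡0⇒j≡-i ab+n≡0

a+b-2r≤ab-r² : ∀ {a b r} → 0ℤ < r → a < b → b < a + b - + 2 * r → a + b - + 2 * r ≤ a * b - r * r
a+b-2r≤ab-r² {a} {b} {r} 0<r a<b b<a+b-2r = ≤-by-gap 0≤excess (identity a b r)
  where
  identity : ∀ a b r → let ρ = r - + 1; p = a + b - + 2 * r - (+ 1 + b); q = b - (+ 1 + a); x = + 2 * ρ + p in
    a + b - + 2 * r + ((ρ + p) * (+ 3 * ρ + p) + x * q + + 5 * x + + 2 * q + + 6) ≡ a * b - r * r
  identity = solve-∀
  ρ p q x : ℤ
  ρ = r - + 1
  p = a + b - + 2 * r - (+ 1 + b)
  q = b - (+ 1 + a)
  x = + 2 * ρ + p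
  0≤ρ : 0ℤ ≤ ρ
  0≤ρ = i<j⇒0≤j-[1+i] 0<r
  0≤p : 0ℤ ≤ p
  0≤p = i<j⇒0≤j-[1+i] b<a+b-2r
  0≤q : 0ℤ ≤ q
  0≤q = i<j⇒0≤j-[1+i] a<b
  0≤x : 0ℤ ≤ x
  0≤x = 0≤+ 2 ⊗ 0≤ρ ⊕ 0≤p
  0≤excess : 0ℤ ≤ (ρ + p) * (+ 3 * ρ + p) + x * q + + 5 * x + + 2 * q + + 6
  0≤excess = (0≤ρ ⊕ 0≤p) ⊗ (0≤+ 3 ⊗ 0≤ρ ⊕ 0≤p) ⊕ 0≤x ⊗ 0≤q ⊕ 0≤+ 5 ⊗ 0≤x ⊕ 0≤+ 2 ⊗ 0≤q ⊕ 0≤+ 6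

c₋≤n² : ∀ {n a b r} → 0ℤ < r → a < b → b < a + b - + 2 * r → r * r ≡ a * b + n → a + b - + 2 * r ≤ n * n
c₋≤n² {n} {a} {b} {r} 0<r a<b b<c₋ r² = begin
  a + b - + 2 * r      ≤⟨ a+b-2r≤ab-r² 0<r a<b b<c₋ ⟩
  a * b - r * r        ≡⟨ cong (λ R → a * b - R) r² ⟩
  a * b - (a * b + n)  ≡⟨ solve (n ∷ a ∷ b ∷ []) ⟩
  - n                  ≤⟨ i≤i*i (- n) ⟩
  - n * - n            ≡⟨ solve (n ∷ []) ⟩
  n * n                ∎
  where open ≤-Reasoning

0<e⇒3ab<n²c : ∀ n {a b c r w} → 0ℤ < a → a < b → b < c → 0ℤ < r → 0ℤ ≤ w →
  let e = dujella-e n a b c w in 0ℤ < e →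
  e * (e + + 4 * w) ≡ n * n * ((c - (a + b + + 2 * r)) * (c - (a + b - + 2 * r))) →
  + 3 * a * b < n * n * c
0<e⇒3ab<n²c n {a} {b} {c} {r} {w} 0<a a<b b<c 0<r 0≤w 0<e e-product =
  *-cancelˡ-<-nonNeg {i = + 3 * a * b} {j = n * n * c} c {{nonNegative 0≤c}} c*3ab<c*n²c
  where
  identity : ∀ n a b c r w →
    let e = n * (a + b + c) + + 2 * a * b * c - + 2 * w
        α = a - + 1; β = b - (+ 1 + a); γ = c - (+ 1 + b); ρ = r - + 1; ε = e - + 1 in
    + 1 + c * (+ 3 * a * b)
      + (ε * (ε + + 4 * w) + n * n * ((α + b) * (β + + 2 * γ) + + 4 * ρ * (ρ + + 2) + + 1)
         + + 2 * (a + b + c) * (n * (n + + 1)) + α * b * c + (α + β) * c + + 2 * (b + γ))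
      + n * n * ((c - (a + b + + 2 * r)) * (c - (a + b - + 2 * r)))
    ≡ c * (n * n * c) + e * (e + + 4 * w)
  identity = solve-∀
  e α β γ ρ ε N excess : ℤ
  e = dujella-e n a b c w
  α = a - + 1
  β = b - (+ 1 + a)
  γ = c - (+ 1 + b)
  ρ = r - + 1
  ε = e - + 1
  N = n * n * ((c - (a + b + + 2 * r)) * (c - (a + b - + 2 * r)))
  -- excess = (e − 1)(e − 1 + 4w) + R − 1; the term 2n(a + b + c) of R, negative for n < 0, is rewritten
  -- as 2(a + b + c)·n(n + 1) − 2(a + b + c)·n², and n(n + 1) ≥ 0 for every integer n.
  excess = ε * (ε + + 4 * w) + n * n * ((α + b) * (β + + 2 * γ) + + 4 * ρ * (ρ + + 2) + + 1)
           + + 2 * (a + b + c) * (n * (n + + 1)) + α * b * c + (α + β) * c + + 2 * (b + γ)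
  0≤α : 0ℤ ≤ α
  0≤α = i<j⇒0≤j-[1+i] 0<a
  0≤β : 0ℤ ≤ β
  0≤β = i<j⇒0≤j-[1+i] a<b
  0≤γ : 0ℤ ≤ γ
  0≤γ = i<j⇒0≤j-[1+i] b<c
  0≤ρ : 0ℤ ≤ ρ
  0≤ρ = i<j⇒0≤j-[1+i] 0<r
  0≤ε : 0ℤ ≤ ε
  0≤ε = i<j⇒0≤j-[1+i] 0<e
  0≤a : 0ℤ ≤ a
  0≤a = <⇒≤ 0<a
  0≤b : 0ℤ ≤ b
  0≤b = <⇒≤ (<-trans 0<a a<b)
  0≤c : 0ℤ ≤ c
  0≤c = <⇒≤ (<-trans (<-trans 0<a a<b) b<c)
  0≤excess : 0ℤ ≤ excess
  0≤excess = 0≤ε ⊗ (0≤ε ⊕ 0≤+ 4 ⊗ 0≤w)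
           ⊕ 0≤i*i n ⊗ ((0≤α ⊕ 0≤b) ⊗ (0≤β ⊕ 0≤+ 2 ⊗ 0≤γ) ⊕ 0≤+ 4 ⊗ 0≤ρ ⊗ (0≤ρ ⊕ 0≤+ 2) ⊕ 0≤+ 1)
           ⊕ 0≤+ 2 ⊗ (0≤a ⊕ 0≤b ⊕ 0≤c) ⊗ 0≤i*[i+1] n ⊕ 0≤α ⊗ 0≤b ⊗ 0≤c ⊕ (0≤α ⊕ 0≤β) ⊗ 0≤c ⊕ 0≤+ 2 ⊗ (0≤b ⊕ 0≤γ)
  c*3ab<c*n²c : c * (+ 3 * a * b) < c * (n * n * c)
  c*3ab<c*n²c = <-by-gap 0≤excess (+-cancelʳ N (+ 1 + c * (+ 3 * a * b) + excess) (c * (n * n * c)) (begin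
    + 1 + c * (+ 3 * a * b) + excess + N  ≡⟨ identity n a b c r w ⟩
    c * (n * n * c) + e * (e + + 4 * w)   ≡⟨ cong (λ E → c * (n * n * c) + E) e-product ⟩
    c * (n * n * c) + N                   ∎))
    where open ≡-Reasoning

lemma24 : (n a b c : ℤ) → n ≢ + 0 → DTriple n a b c → Irregular n a b c → n * n < c → + 3 * a * b < n * n * c
lemma24 n a b c n≢0 (0<a , a<b , b<c , □ab , □ac , □bc) irregular n²<c
  with natural-root □ab | natural-root □ac | natural-root □bc
... | zero , 0≡ab+n | _ | _ = ab+n≡0⇒3ab<n²c n 0<a a<b b<c (sym 0≡ab+n)
... | suc ρ , r² | s , s² | t , t² = case e ≟ 0ℤ of λ where
      (no e≢0)  → 0<e⇒3ab<n²c n 0<a a<b b<c 0<r 0≤rst (≤∧≢⇒< (dujella-e-nonNeg n²<c) (e≢0 ∘ sym))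
                    e*[e+4rst]≡n²[c-c₊][c-c₋]
      (yes e≡0) → ⊥-elim ([ regular , c₋-too-small ]′ (e≡0⇒c≡a+b±2r n≢0 e≡0))
  where
  r : ℤ
  r = + suc ρ
  open Roots n a b c r (+ s) (+ t) r² s² t²
  e : ℤ
  e = dujella-e n a b c (r * + s * + t)
  0<r : 0ℤ < r
  0<r = +<+ (s≤s z≤n)
  0≤rst : 0ℤ ≤ r * + s * + t
  0≤rst = <⇒≤ 0<r ⊗ 0≤+ s ⊗ 0≤+ t
  regular : c ≢ a + b + + 2 * r
  regular c≡c₊ = irregular (r , <⇒≤ 0<r , r² , c≡c₊)
  c₋-too-small : c ≢ a + b - + 2 * r
  c₋-too-small c≡c₋ = <⇒≱ n²<c (subst (_≤ n * n) (sym c≡c₋) (c₋≤n² 0<r a<b (subst (b <_) c≡c₋ b<c) r²))
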